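{- Let $a,b,c,d\in\mathbb{Z}$ with $a\neq 0$ and $c\neq 0$, and let $f(x)=ax+b$ and $g(x)=cx+d$. Then $$\liminf_{N\to\infty}\frac{1}{2N+1}\Big|\{x\in\mathbb{Z} : -N\le x\le N,\ \gcd(f(x),g(x))=1\}\Big|>0$$ if and only if $\gcd(a,b,c,d)=1$ and $ad\neq bc$.
   Context: $\gcd(a_1,\ldots,a_n)$ denotes the (nonnegative) greatest common divisor of the integers $a_1,\ldots,a_n$. -}

module Defs where

open import Data.Nat using (ℕ; suc; _≤_)
import Data.Nat as ℕ
open import Data.Integer using (ℤ; +_; _-_; _*_; _+_)
import Data.Integer as ℤ
open import Data.Integer.GCD using (gcd)
open import Data.List using (List; map; upTo; filter; length)
open import Data.Rational using (ℚ; _/_; 0ℚ; _<_) renaming (_≤_ to _≤ℚ_)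
open import Data.Product using (Σ; _×_; ∃)
open import Relation.Binary.PropositionalEquality using (_≡_)

interval : ℕ → List ℤ
interval N = map (λ i → + i - + N) (upTo (suc (2 ℕ.* N)))

coprimeCount : ℤ → ℤ → ℤ → ℤ → ℕ → ℕ
coprimeCount a b c d N =
  length (filter (λ x → gcd (a * x + b) (c * x + d) ℤ.≟ + 1) (interval N))

density : ℤ → ℤ → ℤ → ℤ → ℕ → ℚ
density a b c d N = + coprimeCount a b c d N / suc (2 ℕ.* N)

-- liminf_{N→∞} u(N) > 0  unfolded: there is a rational ε > 0 with
-- ε ≤ u(N) for all sufficiently large N.
LiminfPositive : (ℕ → ℚ) → Set
LiminfPositive u = Σ ℚ λ ε → (0ℚ < ε) × ∃ λ N₀ → ∀ N → N₀ ≤ N → ε ≤ℚ u N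

gcd4 : ℤ → ℤ → ℤ → ℤ → ℤ
gcd4 a b c d = gcd (gcd a b) (gcd c d)

{-# OPTIONS --safe #-}
-- If g = gcd(a,b,c,d) ≠ 1 then g divides every gcd(ax+b, cx+d), so no point is counted.
-- If ad = bc then c(ax+b) = (cx+d)a, so when ax+b is coprime to cx+d it divides a; hence
-- |ax+b| ≤ |a|, two counted points are at distance at most 2, and at most three are counted.
-- Conversely let M = |cb − ad| ≠ 0 and let w be the largest divisor of M coprime to
-- v = gcd(b,d). A prime p dividing ax+b and cx+d divides c(ax+b) − a(cx+d) = cb − ad, so for
-- x ≡ w (mod M) it also divides aw+b and cw+d. If p ∣ v, then p ∤ w forces p ∣ a and p ∣ c,
-- so p ∣ gcd(a,b,c,d); if p ∤ v, then p ∣ w forces p ∣ b and p ∣ d, so p ∣ v. Hence every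
-- x ≡ w (mod M) is counted, and the density is at least 1/(2M) once N ≥ M.
module Submission where

module Counting where

  open import Data.Nat
  open import Data.Nat.DivMod using (_/_; _%_; m≡m%n+[m/n]*n; m%n<n; m/n*n≤m; m≥n⇒m/n>0)
  open import Data.Nat.Properties
  open import Data.List using (filter; length; applyUpTo)
  open import Data.Product using (∃-syntax; _×_; _,_)
  open import Level using (Level)
  open import Relation.Nullary using (yes; no; contradiction)
  open import Relation.Unary using (Pred; Decidable; _⊆_)
  open import Relation.Binary.PropositionalEquality

  private
    variable
      a ℓ : Level
      A : Set a
      P : Pred ℕ ℓ

  countBelow : Decidable P → ℕ → ℕ
  countBelow P? zero = 0
  countBelow P? (suc n) with P? 0
  ... | yes _ = suc (countBelow (λ i → P? (suc i)) n)
  ... | no  _ = countBelow (λ i → P? (suc i)) n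

  length-filter-applyUpTo : {Q : Pred A ℓ} (Q? : Decidable Q) (f : ℕ → A) (n : ℕ) →
                            length (filter Q? (applyUpTo f n)) ≡ countBelow (λ i → Q? (f i)) n
  length-filter-applyUpTo Q? f zero = refl
  length-filter-applyUpTo Q? f (suc n) with Q? (f 0)
  ... | yes _ = cong suc (length-filter-applyUpTo Q? (λ i → f (suc i)) n)
  ... | no  _ = length-filter-applyUpTo Q? (λ i → f (suc i)) n

  countBelow-+ : (P? : Decidable P) (m n : ℕ) →
                 countBelow P? (m + n) ≡ countBelow P? m + countBelow (λ i → P? (m + i)) n
  countBelow-+ P? zero n = refl
  countBelow-+ P? (suc m) n with P? 0
  ... | yes _ = cong suc (countBelow-+ (λ i → P? (suc i)) m n)
  ... | no  _ = countBelow-+ (λ i → P? (suc i)) m n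

  countBelow-monoʳ-≤ : (P? : Decidable P) {m n : ℕ} → m ≤ n → countBelow P? m ≤ countBelow P? n
  countBelow-monoʳ-≤ P? {m} {n} m≤n = begin
    countBelow P? m                                              ≤⟨ m≤m+n _ _ ⟩
    countBelow P? m + countBelow (λ i → P? (m + i)) (n ∸ m)      ≡⟨ countBelow-+ P? m (n ∸ m) ⟨
    countBelow P? (m + (n ∸ m))                                  ≡⟨ cong (countBelow P?) (m+[n∸m]≡n m≤n) ⟩
    countBelow P? n                                              ∎
    where open ≤-Reasoning

  countBelow>0 : (P? : Decidable P) {i n : ℕ} → i < n → P i → 0 < countBelow P? n
  countBelow>0 P? {zero} {suc n} _ P0 with P? 0
  ... | yes _  = z<s
  ... | no ¬P0 = contradiction P0 ¬P0
  countBelow>0 P? {suc i} {suc n} (s≤s i<n) Pi with P? 0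
  ... | yes _ = z<s
  ... | no  _ = countBelow>0 (λ j → P? (suc j)) i<n Pi

  countBelow-≤ : (P? : Decidable P) {w : ℕ} → P ⊆ (_< w) → (n : ℕ) → countBelow P? n ≤ w
  countBelow-≤ P? P⊆<w zero = z≤n
  countBelow-≤ P? {w} P⊆<w (suc n) with P? 0 | w
  ... | yes P0 | zero  = contradiction (P⊆<w P0) n≮0
  ... | yes P0 | suc _ = s≤s (countBelow-≤ (λ i → P? (suc i)) (λ P1+j → ≤-pred (P⊆<w P1+j)) n)
  ... | no  _  | _     = countBelow-≤ (λ i → P? (suc i)) (λ P1+j → <-trans (n<1+n _) (P⊆<w P1+j)) n

  countBelow-≤-of-close : (P? : Decidable P) {k : ℕ} → (∀ {i j} → P i → P j → j ≤ i + k) →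
                          (n : ℕ) → countBelow P? n ≤ suc k
  countBelow-≤-of-close P? close zero = z≤n
  countBelow-≤-of-close P? {k} close (suc n) with P? 0
  ... | yes P0 = s≤s (countBelow-≤ (λ i → P? (suc i)) (close P0) n)
  ... | no  _  = countBelow-≤-of-close (λ i → P? (suc i)) (λ P1+i P1+j → ≤-pred (close P1+i P1+j)) n

  countBelow-≥-blocks : (P? : Decidable P) {M : ℕ} → (∀ s → ∃[ i ] i < M × P (s + i)) →
                        (q : ℕ) → q ≤ countBelow P? (q * M)
  countBelow-≥-blocks P? blocks zero = z≤n
  countBelow-≥-blocks {P = P} P? {M} blocks (suc q) = begin
    1 + q                                                   ≤⟨ +-mono-≤ first-block rest ⟩
    countBelow P? M + countBelow (λ i → P? (M + i)) (q * M)  ≡⟨ countBelow-+ P? M (q * M) ⟨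
    countBelow P? (suc q * M)                               ∎
    where
    open ≤-Reasoning
    first-block : 0 < countBelow P? M
    first-block = let i , i<M , Pi = blocks 0 in countBelow>0 P? i<M Pi
    shifted-blocks : ∀ s → ∃[ i ] i < M × P (M + (s + i))
    shifted-blocks s = let i , i<M , Pi = blocks (M + s) in i , i<M , subst P (+-assoc M s i) Pi
    rest : q ≤ countBelow (λ i → P? (M + i)) (q * M)
    rest = countBelow-≥-blocks (λ i → P? (M + i)) shifted-blocks q

  countBelow-≥-linear : (P? : Decidable P) {M : ℕ} .{{_ : NonZero M}} →
                        (∀ s → ∃[ i ] i < M × P (s + i)) →
                        {n : ℕ} → M ≤ n → n ≤ countBelow P? n * (M + M)
  countBelow-≥-linear P? {M} blocks {n} M≤n = begin
    n                     ≡⟨ m≡m%n+[m/n]*n n M ⟩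
    n % M + q * M         ≤⟨ +-monoˡ-≤ (q * M) (≤-trans (<⇒≤ (m%n<n n M)) M≤q*M) ⟩
    q * M + q * M         ≡⟨ *-distribˡ-+ q M M ⟨
    q * (M + M)           ≤⟨ *-monoˡ-≤ (M + M) q≤count ⟩
    countBelow P? n * (M + M) ∎
    where
    open ≤-Reasoning
    q = n / M
    M≤q*M : M ≤ q * M
    M≤q*M = m≤n*m M q {{>-nonZero (m≥n⇒m/n>0 M≤n)}}
    q≤count : q ≤ countBelow P? n
    q≤count = ≤-trans (countBelow-≥-blocks P? blocks q) (countBelow-monoʳ-≤ P? (m/n*n≤m n M))

module Density where

  open import Data.Nat as ℕ using (ℕ; suc; NonZero; z<s)
  import Data.Nat.Properties as ℕ
  open import Data.Nat.Coprimality using (1-coprimeTo)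
  open import Data.Integer as ℤ using (ℤ; +_; +[1+_]; +<+; +≤+)
  import Data.Integer.Properties as ℤ
  open import Data.Rational using (ℚ; mkℚ; 0ℚ; ↥_; ↧_; ↧ₙ_; _/_; _≤_; _<_; *<*; toℚᵘ)
  open import Data.Rational.Properties using (toℚᵘ-mono-≤; toℚᵘ-cancel-≤; toℚᵘ-fromℚᵘ)
  import Data.Rational.Unnormalised as ℚᵘ
  import Data.Rational.Unnormalised.Properties as ℚᵘ
  open import Data.Product using (_,_)
  open import Function.Bundles using (_⇔_; mk⇔; Equivalence)
  open import Relation.Binary.PropositionalEquality using (refl; sym; subst₂)
  open import Relation.Nullary using (¬_)
  open import Defs using (LiminfPositive)

  ≤-/-⇔ : ∀ {p : ℚ} (i : ℤ) (m : ℕ) → p ≤ i / suc m ⇔ ↥ p ℤ.* + suc m ℤ.≤ i ℤ.* ↧ p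
  ≤-/-⇔ {p@record{}} i m = mk⇔ to from
    where
    i/m≃i/m : toℚᵘ (i / suc m) ℚᵘ.≃ ℚᵘ.mkℚᵘ i m
    i/m≃i/m = toℚᵘ-fromℚᵘ (ℚᵘ.mkℚᵘ i m)
    to : p ≤ i / suc m → ↥ p ℤ.* + suc m ℤ.≤ i ℤ.* ↧ p
    to p≤i/m with ℚᵘ.≤-respʳ-≃ i/m≃i/m (toℚᵘ-mono-≤ p≤i/m)
    ... | ℚᵘ.*≤* le = le
    from : ↥ p ℤ.* + suc m ℤ.≤ i ℤ.* ↧ p → p ≤ i / suc m
    from le = toℚᵘ-cancel-≤ (ℚᵘ.≤-respʳ-≃ (ℚᵘ.≃-sym i/m≃i/m) (ℚᵘ.*≤* le))

  positive-≤-/⇒≤ : ∀ {ε : ℚ} (c m : ℕ) → 0ℚ < ε → ε ≤ + c / suc m → suc m ℕ.≤ c ℕ.* ↧ₙ ε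
  positive-≤-/⇒≤ {mkℚ +[1+ k ] d _} c m _ ε≤c/m = ℕ.≤-trans (ℕ.m≤n*m (suc m) (suc k))
    (ℤ.drop‿+≤+ (subst₂ ℤ._≤_ refl (sym (ℤ.pos-* c (suc d))) (Equivalence.to (≤-/-⇔ (+ c) m) ε≤c/m)))
  positive-≤-/⇒≤ {mkℚ (+ 0) _ _} _ _ (*<* (+<+ ()))
  positive-≤-/⇒≤ {mkℚ ℤ.-[1+ _ ] _ _} _ _ (*<* ())

  ¬LiminfPositive-of-bounded : (f : ℕ → ℕ) (K : ℕ) → (∀ N → f N ℕ.≤ K) →
                               ¬ LiminfPositive (λ N → + f N / suc (2 ℕ.* N))
  ¬LiminfPositive-of-bounded f K f≤K (ε , ε>0 , N₀ , lower) = ℕ.<-irrefl refl (begin-strict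
    N                  <⟨ ℕ.s≤s (ℕ.m≤m+n N (N ℕ.+ 0)) ⟩
    suc (2 ℕ.* N)      ≤⟨ positive-≤-/⇒≤ (f N) (2 ℕ.* N) ε>0 (lower N (ℕ.m≤m+n N₀ (K ℕ.* D))) ⟩
    f N ℕ.* D          ≤⟨ ℕ.*-monoˡ-≤ D (f≤K N) ⟩
    K ℕ.* D            ≤⟨ ℕ.m≤n+m (K ℕ.* D) N₀ ⟩
    N                  ∎)
    where
    open ℕ.≤-Reasoning
    D = ↧ₙ ε
    N = N₀ ℕ.+ K ℕ.* D

  LiminfPositive-of-linear : (f : ℕ → ℕ) (K : ℕ) .{{_ : NonZero K}} (N₀ : ℕ) →
                             (∀ N → N₀ ℕ.≤ N → suc (2 ℕ.* N) ℕ.≤ f N ℕ.* K) →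
                             LiminfPositive (λ N → + f N / suc (2 ℕ.* N))
  LiminfPositive-of-linear f (suc k) N₀ lower = ε , *<* (+<+ z<s) , N₀ , ε≤density
    where
    ε : ℚ
    ε = mkℚ (+ 1) k (1-coprimeTo (suc k))
    ε≤density : ∀ N → N₀ ℕ.≤ N → ε ≤ + f N / suc (2 ℕ.* N)
    ε≤density N N₀≤N = Equivalence.from (≤-/-⇔ (+ f N) (2 ℕ.* N))
      (subst₂ ℤ._≤_ (sym (ℤ.*-identityˡ _)) (ℤ.pos-* (f N) (suc k)) (+≤+ (lower N N₀≤N)))

module Arithmetic where

  open import Data.Nat as ℕ using (ℕ; zero; suc; NonZero)
  import Data.Nat.Properties as ℕ
  open import Data.Nat.Divisibility using (_∣_; _∣?_; ∣-trans; ∣1⇒≡1; _∣0; ∣⇒≤)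
  open import Data.Nat.GCD as ℕ using (gcd[m,n]∣m; gcd[m,n]∣n; gcd-greatest)
  open import Data.Nat.Coprimality using (gcd≡1⇒coprime)
  open import Data.Nat.Primality using (Prime; euclidsLemma; prime[2]; ¬prime[1])
  open import Data.Nat.Primality.Factorisation
    using (factorise; factors; factorisationHasAllPrimeFactors; PrimeFactorisation)
  open import Data.Nat.ListAction using (product)
  open import Data.Nat.ListAction.Properties using (∈⇒∣product)
  open import Data.Integer as ℤ using (ℤ; +_; ∣_∣; _+_; _-_; _*_; -_; _⊖_)
  import Data.Integer.Properties as ℤ
  open import Data.Integer.Coprimality using (coprime-divisor)
  open import Data.Integer.DivMod using (_%ℕ_; _/ℕ_; n%ℕd<d; a≡a%ℕn+[a/ℕn]*n)
  import Data.Integer.Divisibility.Signed as Signed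
  open import Data.Integer.GCD using (gcd)
  open import Data.Integer.Tactic.RingSolver using (solve-∀)
  open import Data.List using ([]; _∷_; filter)
  open import Data.List.Membership.Propositional using (_∈_)
  open import Data.List.Membership.Propositional.Properties using (∈-filter⁺; ∈-filter⁻)
  open import Data.List.Relation.Unary.All using (_∷_)
  import Data.List.Relation.Unary.All.Properties as All
  open import Data.List.Relation.Unary.Any using (here)
  open import Data.Product using (∃-syntax; _×_; _,_; proj₂)
  open import Data.Sum using (inj₁; inj₂)
  open import Relation.Binary.PropositionalEquality
  open import Function using (_∘_)
  open import Relation.Nullary using (Dec; ¬_; yes; no; ¬?; contradiction)
  open import Data.Empty using (⊥)
  open import Defs using (gcd4)

  CoprimeValues : ℤ → ℤ → ℤ → ℤ → ℤ → Set
  CoprimeValues a b c d x = gcd (a * x + b) (c * x + d) ≡ + 1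

  coprimeValues? : ∀ a b c d x → Dec (CoprimeValues a b c d x)
  coprimeValues? a b c d x = gcd (a * x + b) (c * x + d) ℤ.≟ + 1

  prime∤1 : ∀ {p} → Prime p → ¬ p ∣ 1
  prime∤1 p-prime p∣1 = ¬prime[1] (subst Prime (∣1⇒≡1 p∣1) p-prime)

  ≡1-if-no-prime-divisor : ∀ {n} → (∀ {p} → Prime p → ¬ p ∣ n) → n ≡ 1
  ≡1-if-no-prime-divisor {zero} no-prime = contradiction (2 ∣0) (no-prime prime[2])
  ≡1-if-no-prime-divisor {suc zero} _ = refl
  ≡1-if-no-prime-divisor {n@(suc (suc _))} no-prime with factorise n
  ... | record { factors = [] ; isFactorisation = () }
  ... | record { factors = p ∷ ps ; isFactorisation = n≡Π ; factorsPrime = p-prime ∷ _ } =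
    contradiction (subst (p ∣_) (sym n≡Π) (∈⇒∣product {ns = p ∷ ps} (here refl))) (no-prime p-prime)

  partCoprimeTo : ℕ → (n : ℕ) → .{{NonZero n}} → ℕ
  partCoprimeTo v n = product (filter (λ p → ¬? (p ∣? v)) (factors (factorise n)))

  prime∣partCoprimeTo⇒∤ : ∀ {v n p} .{{_ : NonZero n}} → Prime p → p ∣ partCoprimeTo v n → ¬ p ∣ v
  prime∣partCoprimeTo⇒∤ {v} {n} p-prime p∣w =
    proj₂ (∈-filter⁻ ∤v? {xs = factors (factorise n)}
      (factorisationHasAllPrimeFactors {as = filter ∤v? (factors (factorise n))} p-prime p∣w
        (All.filter⁺ ∤v? (PrimeFactorisation.factorsPrime (factorise n)))))
    where
    ∤v? = λ q → ¬? (q ∣? v)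

  prime∣⇒∣partCoprimeTo : ∀ {v n p} .{{_ : NonZero n}} → Prime p → p ∣ n → ¬ p ∣ v → p ∣ partCoprimeTo v n
  prime∣⇒∣partCoprimeTo {v} {n} {p} p-prime p∣n p∤v =
    ∈⇒∣product (∈-filter⁺ (λ q → ¬? (q ∣? v)) p∈factors p∤v)
    where
    open PrimeFactorisation (factorise n) using (isFactorisation; factorsPrime)
    p∈factors : p ∈ factors (factorise n)
    p∈factors = factorisationHasAllPrimeFactors p-prime (subst (p ∣_) isFactorisation p∣n) factorsPrime

  coprimeValues⇒gcd4≡1 : ∀ {a b c d x} → CoprimeValues a b c d x → gcd4 a b c d ≡ + 1
  coprimeValues⇒gcd4≡1 {a} {b} {c} {d} {x} coprime = cong +_ (∣1⇒≡1 (subst (k ∣_) (ℤ.+-injective coprime)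
    (gcd-greatest (∣value a b k∣a k∣b) (∣value c d k∣c k∣d))))
    where
    g-ab = ℕ.gcd ∣ a ∣ ∣ b ∣
    g-cd = ℕ.gcd ∣ c ∣ ∣ d ∣
    k = ℕ.gcd g-ab g-cd
    k∣a = ∣-trans (gcd[m,n]∣m g-ab g-cd) (gcd[m,n]∣m ∣ a ∣ ∣ b ∣)
    k∣b = ∣-trans (gcd[m,n]∣m g-ab g-cd) (gcd[m,n]∣n ∣ a ∣ ∣ b ∣)
    k∣c = ∣-trans (gcd[m,n]∣n g-ab g-cd) (gcd[m,n]∣m ∣ c ∣ ∣ d ∣)
    k∣d = ∣-trans (gcd[m,n]∣n g-ab g-cd) (gcd[m,n]∣n ∣ c ∣ ∣ d ∣)
    ∣value : ∀ e f → k ∣ ∣ e ∣ → k ∣ ∣ f ∣ → k ∣ ∣ e * x + f ∣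
    ∣value e f k∣e k∣f = Signed.∣⇒∣ᵤ
      (Signed.∣m∣n⇒∣m+n (Signed.∣m⇒∣m*n x (Signed.∣ᵤ⇒∣ {+ k} {e} k∣e)) (Signed.∣ᵤ⇒∣ {+ k} {f} k∣f))

  coprimeValues⇒∣ax+b∣≤∣a∣ : ∀ {a b c d x} → a ≢ + 0 → a * d ≡ b * c → CoprimeValues a b c d x →
                              ∣ a * x + b ∣ ℕ.≤ ∣ a ∣
  coprimeValues⇒∣ax+b∣≤∣a∣ {a} {b} {c} {d} {x} a≢0 ad≡bc coprime =
    ∣⇒≤ {{ℕ.≢-nonZero (a≢0 ∘ ℤ.∣i∣≡0⇒i≡0)}} (coprime-divisor X Y a (gcd≡1⇒coprime (ℤ.+-injective coprime)) X∣Ya)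
    where
    X = a * x + b
    Y = c * x + d
    expand-cX : ∀ a b c x → c * (a * x + b) ≡ a * (c * x) + b * c
    expand-cX = solve-∀
    factor-Ya : ∀ a c d x → a * (c * x) + a * d ≡ (c * x + d) * a
    factor-Ya = solve-∀
    cX≡Ya : c * X ≡ Y * a
    cX≡Ya = begin
      c * X                ≡⟨ expand-cX a b c x ⟩
      a * (c * x) + b * c  ≡⟨ cong (λ t → a * (c * x) + t) ad≡bc ⟨
      a * (c * x) + a * d  ≡⟨ factor-Ya a c d x ⟩
      Y * a                ∎
      where open ≡-Reasoning
    X∣Ya : ∣ X ∣ ∣ ∣ Y * a ∣
    X∣Ya = Signed.∣⇒∣ᵤ (subst (X Signed.∣_) cX≡Ya (Signed.∣n⇒∣m*n c Signed.∣-refl))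

  coprimeValues-close : ∀ {a b c d x y} → a ≢ + 0 → a * d ≡ b * c →
                        CoprimeValues a b c d x → CoprimeValues a b c d y → ∣ y - x ∣ ℕ.≤ 2
  coprimeValues-close {a} {b} {c} {d} {x} {y} a≢0 ad≡bc coprime-x coprime-y =
    ℕ.*-cancelˡ-≤ ∣ a ∣ {{ℕ.≢-nonZero (a≢0 ∘ ℤ.∣i∣≡0⇒i≡0)}} (begin
      ∣ a ∣ ℕ.* ∣ y - x ∣               ≡⟨ ℤ.abs-* a (y - x) ⟨
      ∣ a * (y - x) ∣                   ≡⟨ cong ∣_∣ (difference a b x y) ⟩
      ∣ (a * y + b) - (a * x + b) ∣     ≤⟨ ℤ.∣i-j∣≤∣i∣+∣j∣ (a * y + b) (a * x + b) ⟩
      ∣ a * y + b ∣ ℕ.+ ∣ a * x + b ∣   ≤⟨ ℕ.+-mono-≤ (bound coprime-y) (bound coprime-x) ⟩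
      ∣ a ∣ ℕ.+ ∣ a ∣                   ≡⟨ cong (∣ a ∣ ℕ.+_) (ℕ.+-identityʳ ∣ a ∣) ⟨
      2 ℕ.* ∣ a ∣                       ≡⟨ ℕ.*-comm 2 ∣ a ∣ ⟩
      ∣ a ∣ ℕ.* 2                       ∎)
    where
    open ℕ.≤-Reasoning
    difference : ∀ a b x y → a * (y - x) ≡ (a * y + b) - (a * x + b)
    difference = solve-∀
    bound : ∀ {z} → CoprimeValues a b c d z → ∣ a * z + b ∣ ℕ.≤ ∣ a ∣
    bound = coprimeValues⇒∣ax+b∣≤∣a∣ a≢0 ad≡bc

  m≤n+∣m⊖n∣ : ∀ m n → m ℕ.≤ n ℕ.+ ∣ m ⊖ n ∣
  m≤n+∣m⊖n∣ m n with ℕ.≤-total m n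
  ... | inj₁ m≤n = ℕ.≤-trans m≤n (ℕ.m≤m+n n _)
  ... | inj₂ n≤m = ℕ.≤-reflexive (begin
    m                 ≡⟨ ℕ.m+[n∸m]≡n n≤m ⟨
    n ℕ.+ (m ℕ.∸ n)   ≡⟨ cong (n ℕ.+_) (trans (ℤ.∣m⊖n∣≡∣n⊖m∣ m n) (ℤ.∣⊖∣-≤ n≤m)) ⟨
    n ℕ.+ ∣ m ⊖ n ∣   ∎)
    where open ≡-Reasoning

  [j-N]-[i-N]≡j⊖i : ∀ i j N → (+ j - + N) - (+ i - + N) ≡ j ⊖ i
  [j-N]-[i-N]≡j⊖i i j N = trans (cancel-shift (+ i) (+ j) (+ N)) (ℤ.m-n≡m⊖n j i)
    where
    cancel-shift : ∀ i j N → (j - N) - (i - N) ≡ j - i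
    cancel-shift = solve-∀

  ∣values⇒∣cb-ad : ∀ {k} a b c d x → k Signed.∣ a * x + b → k Signed.∣ c * x + d → k Signed.∣ c * b - a * d
  ∣values⇒∣cb-ad {k} a b c d x k∣X k∣Y =
    subst (k Signed.∣_) (eliminate-x a b c d x) (Signed.∣m∣n⇒∣m-n (Signed.∣n⇒∣m*n c k∣X) (Signed.∣n⇒∣m*n a k∣Y))
    where
    eliminate-x : ∀ a b c d x → c * (a * x + b) - a * (c * x + d) ≡ c * b - a * d
    eliminate-x = solve-∀

  ∣value-congruent : ∀ {k x y} e f → k Signed.∣ x - y → k Signed.∣ e * x + f → k Signed.∣ e * y + f
  ∣value-congruent {k} {x} {y} e f k∣x-y k∣ex+f =
    subst (k Signed.∣_) (shift e f x y) (Signed.∣m∣n⇒∣m-n k∣ex+f (Signed.∣n⇒∣m*n e k∣x-y))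
    where
    shift : ∀ e f x y → (e * x + f) - e * (x - y) ≡ e * y + f
    shift = solve-∀

  module _ {a b c d : ℤ} {w : ℕ} (gcd4≡1 : gcd4 a b c d ≡ + 1)
           (w-avoids : ∀ {p} → Prime p → p ∣ w → ¬ p ∣ (ℕ.gcd ∣ b ∣ ∣ d ∣))
           (w-catches : ∀ {p} → Prime p → p ∣ ∣ c * b - a * d ∣ → ¬ p ∣ (ℕ.gcd ∣ b ∣ ∣ d ∣) → p ∣ w)
           where

    prime∤values-at-w : ∀ {p} → Prime p → p ∣ ∣ c * b - a * d ∣ →
                        + p Signed.∣ a * + w + b → + p Signed.∣ c * + w + d → ⊥
    prime∤values-at-w {p} p-prime p∣M p∣aw+b p∣cw+d with p ∣? (ℕ.gcd ∣ b ∣ ∣ d ∣)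
    ... | yes p∣v = prime∤1 p-prime (subst (p ∣_) (ℤ.+-injective gcd4≡1)
          (gcd-greatest (gcd-greatest (coefficient a b p∣aw+b p∣b) p∣b) (gcd-greatest (coefficient c d p∣cw+d p∣d) p∣d)))
      where
      p∣b = ∣-trans p∣v (gcd[m,n]∣m ∣ b ∣ ∣ d ∣)
      p∣d = ∣-trans p∣v (gcd[m,n]∣n ∣ b ∣ ∣ d ∣)
      coefficient : ∀ e f → + p Signed.∣ e * + w + f → p ∣ ∣ f ∣ → p ∣ ∣ e ∣
      coefficient e f p∣ew+f p∣f
        with euclidsLemma ∣ e ∣ w p-prime (subst (p ∣_) (ℤ.abs-* e (+ w))
               (Signed.∣⇒∣ᵤ (Signed.∣m+n∣n⇒∣m {+ p} {e * + w} {f} p∣ew+f (Signed.∣ᵤ⇒∣ {+ p} {f} p∣f))))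
      ... | inj₁ p∣e = p∣e
      ... | inj₂ p∣w = contradiction p∣v (w-avoids p-prime p∣w)
    ... | no p∤v = p∤v (gcd-greatest (constant a b p∣aw+b) (constant c d p∣cw+d))
      where
      p∣w = w-catches p-prime p∣M p∤v
      constant : ∀ e f → + p Signed.∣ e * + w + f → p ∣ ∣ f ∣
      constant e f p∣ew+f = Signed.∣⇒∣ᵤ (Signed.∣m+n∣m⇒∣n p∣ew+f (Signed.∣n⇒∣m*n e (Signed.∣ᵤ⇒∣ {+ p} {+ w} p∣w)))

    coprimeValues-on-residue-class : ∀ {x} → + ∣ c * b - a * d ∣ Signed.∣ x - + w → CoprimeValues a b c d x
    coprimeValues-on-residue-class {x} M∣x-w = cong +_ (≡1-if-no-prime-divisor no-common-prime)
      where
      X = a * x + b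
      Y = c * x + d
      no-common-prime : ∀ {p} → Prime p → ¬ p ∣ (ℕ.gcd ∣ X ∣ ∣ Y ∣)
      no-common-prime {p} p-prime p∣gcd =
        prime∤values-at-w p-prime p∣M (∣value-congruent a b p∣x-w p∣X) (∣value-congruent c d p∣x-w p∣Y)
        where
        p∣X : + p Signed.∣ X
        p∣X = Signed.∣ᵤ⇒∣ (∣-trans p∣gcd (gcd[m,n]∣m ∣ X ∣ ∣ Y ∣))
        p∣Y : + p Signed.∣ Y
        p∣Y = Signed.∣ᵤ⇒∣ (∣-trans p∣gcd (gcd[m,n]∣n ∣ X ∣ ∣ Y ∣))
        p∣M : p ∣ ∣ c * b - a * d ∣
        p∣M = Signed.∣⇒∣ᵤ (∣values⇒∣cb-ad a b c d x p∣X p∣Y)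
        p∣x-w : + p Signed.∣ x - + w
        p∣x-w = Signed.∣-trans (Signed.∣ᵤ⇒∣ p∣M) M∣x-w

  block-meets-residue-class : ∀ M .{{_ : NonZero M}} (z : ℤ) (s : ℕ) →
                              ∃[ i ] i ℕ.< M × + M Signed.∣ + (s ℕ.+ i) - z
  block-meets-residue-class M z s = r , n%ℕd<d (z - + s) M , Signed.divides (- q) s+r-z≡-qM
    where
    r = (z - + s) %ℕ M
    q = (z - + s) /ℕ M
    rearrange : ∀ s r z → (s + r) - z ≡ r - (z - s)
    rearrange = solve-∀
    cancel : ∀ r q M → r - (r + q * M) ≡ - q * M
    cancel = solve-∀
    s+r-z≡-qM : + (s ℕ.+ r) - z ≡ - q * + M
    s+r-z≡-qM = begin
      + (s ℕ.+ r) - z           ≡⟨ cong (_- z) (ℤ.pos-+ s r) ⟩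
      (+ s + + r) - z           ≡⟨ rearrange (+ s) (+ r) z ⟩
      + r - (z - + s)           ≡⟨ cong (λ t → + r - t) (a≡a%ℕn+[a/ℕn]*n (z - + s) M) ⟩
      + r - (+ r + q * + M)     ≡⟨ cancel (+ r) q (+ M) ⟩
      - q * + M                 ∎
      where open ≡-Reasoning

open import Defs
open import Data.Integer using (ℤ; +_; _*_)
open import Data.Product using (_×_)
open import Function.Bundles using (_⇔_)
open import Relation.Binary.PropositionalEquality using (_≡_)
open import Relation.Nullary using (¬_)

open import Data.Nat as ℕ using (ℕ; suc)
import Data.Nat.Properties as ℕ
import Data.Nat.GCD as ℕ using (gcd)
import Data.Integer as ℤ
open import Data.Integer using (∣_∣; _+_; _-_)
import Data.Integer.Properties as ℤ
import Data.Integer.Divisibility.Signed as Signed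
open import Data.Integer.Tactic.RingSolver using (solve-∀)
open import Data.List using (filter; length)
open import Data.List.Properties using (map-upTo)
open import Data.Product using (∃-syntax; _,_; uncurry)
open import Function.Bundles using (mk⇔)
open import Relation.Binary.PropositionalEquality using (sym; trans; cong; subst)
open import Relation.Nullary using (Dec; contradiction)
open import Relation.Nullary.Decidable using (decidable-stable)
open Counting
open Density
open Arithmetic

module _ (a b c d : ℤ) where

  coprimeAt? : (N i : ℕ) → Dec (CoprimeValues a b c d (+ i - + N))
  coprimeAt? N i = coprimeValues? a b c d (+ i - + N)

  coprimeCount≡countBelow : ∀ N → coprimeCount a b c d N ≡ countBelow (coprimeAt? N) (suc (2 ℕ.* N))
  coprimeCount≡countBelow N =
    trans (cong (λ xs → length (filter (coprimeValues? a b c d) xs)) (map-upTo shift (suc (2 ℕ.* N))))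
          (length-filter-applyUpTo (coprimeValues? a b c d) shift (suc (2 ℕ.* N)))
    where
    shift : ℕ → ℤ
    shift i = + i - + N

  gcd4≢1⇒coprimeCount≤0 : ¬ (gcd4 a b c d ≡ + 1) → ∀ N → coprimeCount a b c d N ℕ.≤ 0
  gcd4≢1⇒coprimeCount≤0 gcd4≢1 N = subst (ℕ._≤ 0) (sym (coprimeCount≡countBelow N))
    (countBelow-≤ (coprimeAt? N) (λ coprime → contradiction (coprimeValues⇒gcd4≡1 {a} {b} {c} {d} coprime) gcd4≢1) _)

  ad≡bc⇒coprimeCount≤3 : ¬ (a ≡ + 0) → a * d ≡ b * c → ∀ N → coprimeCount a b c d N ℕ.≤ 3
  ad≡bc⇒coprimeCount≤3 a≢0 ad≡bc N = subst (ℕ._≤ 3) (sym (coprimeCount≡countBelow N))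
    (countBelow-≤-of-close (coprimeAt? N) close _)
    where
    close : ∀ {i j} → CoprimeValues a b c d (+ i - + N) → CoprimeValues a b c d (+ j - + N) → j ℕ.≤ i ℕ.+ 2
    close {i} {j} coprime-i coprime-j = ℕ.≤-trans (m≤n+∣m⊖n∣ j i) (ℕ.+-monoʳ-≤ i
      (subst (λ t → ∣ t ∣ ℕ.≤ 2) ([j-N]-[i-N]≡j⊖i i j N) (coprimeValues-close a≢0 ad≡bc coprime-i coprime-j)))

  gcd4≡1∧ad≢bc⇒LiminfPositive : gcd4 a b c d ≡ + 1 → ¬ (a * d ≡ b * c) → LiminfPositive (density a b c d)
  gcd4≡1∧ad≢bc⇒LiminfPositive gcd4≡1 ad≢bc = LiminfPositive-of-linear (coprimeCount a b c d) (M ℕ.+ M) M linear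
    where
    M = ∣ c * b - a * d ∣
    instance
      M≢0 : ℕ.NonZero M
      M≢0 = ℕ.≢-nonZero λ M≡0 → ad≢bc (sym (trans (ℤ.*-comm b c) (ℤ.i-j≡0⇒i≡j _ _ (ℤ.∣i∣≡0⇒i≡0 M≡0))))
      2M≢0 : ℕ.NonZero (M ℕ.+ M)
      2M≢0 = ℕ.>-nonZero (ℕ.<-≤-trans (ℕ.>-nonZero⁻¹ M) (ℕ.m≤m+n M M))
    v = ℕ.gcd ∣ b ∣ ∣ d ∣
    w = partCoprimeTo v M
    regroup : ∀ t N w → t - (N + w) ≡ (t - N) - w
    regroup = solve-∀
    blocks : ∀ N s → ∃[ i ] i ℕ.< M × CoprimeValues a b c d (+ (s ℕ.+ i) - + N)
    blocks N s =
      let i , i<M , M∣s+i-[N+w] = block-meets-residue-class M (+ N + + w) s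
      in i , i<M , coprimeValues-on-residue-class {a} {b} {c} {d} {w} gcd4≡1
           (prime∣partCoprimeTo⇒∤ {v} {M}) (prime∣⇒∣partCoprimeTo {v} {M})
           (subst (+ M Signed.∣_) (regroup (+ (s ℕ.+ i)) (+ N) (+ w)) M∣s+i-[N+w])
    linear : ∀ N → M ℕ.≤ N → suc (2 ℕ.* N) ℕ.≤ coprimeCount a b c d N ℕ.* (M ℕ.+ M)
    linear N M≤N = subst (λ k → suc (2 ℕ.* N) ℕ.≤ k ℕ.* (M ℕ.+ M)) (sym (coprimeCount≡countBelow N))
      (countBelow-≥-linear (coprimeAt? N) (blocks N) (ℕ.≤-trans M≤N (ℕ.≤-trans (ℕ.m≤m+n N (N ℕ.+ 0)) (ℕ.n≤1+n _))))

theorem1p1 : (a b c d : ℤ) → ¬ (a ≡ + 0) → ¬ (c ≡ + 0) →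
    (LiminfPositive (density a b c d) ⇔ ((gcd4 a b c d ≡ + 1) × ¬ (a * d ≡ b * c)))
theorem1p1 a b c d a≢0 _ = mk⇔ necessary (uncurry (gcd4≡1∧ad≢bc⇒LiminfPositive a b c d))
  where
  ¬positive-if-count≤ : ∀ K → (∀ N → coprimeCount a b c d N ℕ.≤ K) → ¬ LiminfPositive (density a b c d)
  ¬positive-if-count≤ = ¬LiminfPositive-of-bounded (coprimeCount a b c d)
  necessary : LiminfPositive (density a b c d) → (gcd4 a b c d ≡ + 1) × ¬ (a * d ≡ b * c)
  necessary positive =
      decidable-stable (gcd4 a b c d ℤ.≟ + 1)
        (λ gcd4≢1 → ¬positive-if-count≤ 0 (gcd4≢1⇒coprimeCount≤0 a b c d gcd4≢1) positive)
    , λ ad≡bc → ¬positive-if-count≤ 3 (ad≡bc⇒coprimeCount≤3 a b c d a≢0 ad≡bc) positive
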